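{- Let $L$ be either of the sequent calculi $\mathrm{lTS4}$ or $\mathrm{gTS4}$ defined in the context. Then the rules ($\neg$left) $\Gamma\Rightarrow\Delta,\alpha$ / $\neg\alpha,\Gamma\Rightarrow\Delta$ and ($\neg$right) $\alpha,\Gamma\Rightarrow\Delta$ / $\Gamma\Rightarrow\Delta,\neg\alpha$ are admissible in cut-free $L$.
   Context: Formulas are built from countably many propositional variables using the binary connectives $\wedge,\vee,\to$ and the unary connectives $\neg,\Box,\Diamond$. Letters $\Gamma,\Delta$ (possibly with subscripts) denote finite, possibly empty, sets of formulas; a sequent is an expression $\Gamma\Rightarrow\Delta$; a comma denotes union. For a word $w$ over $\{\neg,\Box,\Diamond\}$, $w\Gamma=\{w\gamma:\gamma\in\Gamma\}$. A rule "$S_1;\dots;S_n\,/\,S$" has premises $S_1,\dots,S_n$ and conclusion $S$. "Cut-free $L$" means the system $L$ with the rule (cut) removed. A rule $R$ is admissible in a calculus $M$ if for every instance of $R$ with premises $S_1,\dots,S_n$ and conclusion $S$, whenever every $S_i$ is provable in $M$, $S$ is provable in $M$. The calculus lTS4. Initial sequents: for every propositional variable $p$: $p\Rightarrow p$, $\neg p\Rightarrow\neg p$, $\neg p,p\Rightarrow$, and $\Rightarrow\neg p,p$. Structural rules: (cut) $\Gamma\Rightarrow\alpha$; $\alpha,\Gamma\Rightarrow\Delta$ / $\Gamma\Rightarrow\Delta$. (we-left) $\Gamma\Rightarrow\Delta$ / $\alpha,\Gamma\Rightarrow\Delta$. (we-right) $\Gamma\Rightarrow\Delta$ / $\Gamma\Rightarrow\Delta,\alpha$.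 Non-twist logical rules: ($\wedge$left) $\alpha,\beta,\Gamma\Rightarrow\Delta$ / $\alpha\wedge\beta,\Gamma\Rightarrow\Delta$. ($\wedge$right) $\Gamma\Rightarrow\Delta,\alpha$; $\Gamma\Rightarrow\Delta,\beta$ / $\Gamma\Rightarrow\Delta,\alpha\wedge\beta$. ($\vee$left) $\alpha,\Gamma\Rightarrow\Delta$; $\beta,\Gamma\Rightarrow\Delta$ / $\alpha\vee\beta,\Gamma\Rightarrow\Delta$. ($\vee$right) $\Gamma\Rightarrow\Delta,\alpha,\beta$ / $\Gamma\Rightarrow\Delta,\alpha\vee\beta$. ($\to$left) $\Gamma\Rightarrow\Delta,\alpha$; $\beta,\Gamma\Rightarrow\Delta$ / $\alpha\to\beta,\Gamma\Rightarrow\Delta$. ($\to$right) $\alpha,\Gamma\Rightarrow\Delta,\beta$ / $\Gamma\Rightarrow\Delta,\alpha\to\beta$. ($\Box$left) $\alpha,\Gamma\Rightarrow\Delta$ / $\Box\alpha,\Gamma\Rightarrow\Delta$. ($\Box$right) $\Box\Gamma_1,\neg\Diamond\Gamma_2\Rightarrow\Diamond\Delta_1,\neg\Box\Delta_2,\alpha$ / $\Box\Gamma_1,\neg\Diamond\Gamma_2\Rightarrow\Diamond\Delta_1,\neg\Box\Delta_2,\Box\alpha$. ($\Diamond$left) $\alpha,\Box\Gamma_1,\neg\Diamond\Gamma_2\Rightarrow\Diamond\Delta_1,\neg\Box\Delta_2$ / $\Diamond\alpha,\Box\Gamma_1,\neg\Diamond\Gamma_2\Rightarrow\Diamond\Delta_1,\neg\Box\Delta_2$.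 ($\Diamond$right) $\Gamma\Rightarrow\Delta,\alpha$ / $\Gamma\Rightarrow\Delta,\Diamond\alpha$. Twist rules: ($\neg\neg$left$^t$) $\alpha,\Gamma\Rightarrow\Delta$ / $\neg\neg\alpha,\Gamma\Rightarrow\Delta$. ($\neg\neg$right$^t$) $\Gamma\Rightarrow\Delta,\alpha$ / $\Gamma\Rightarrow\Delta,\neg\neg\alpha$. ($\neg\wedge$left$^t$) $\Gamma\Rightarrow\Delta,\alpha$; $\Gamma\Rightarrow\Delta,\beta$ / $\neg(\alpha\wedge\beta),\Gamma\Rightarrow\Delta$. ($\neg\wedge$right$^t$) $\alpha,\beta,\Gamma\Rightarrow\Delta$ / $\Gamma\Rightarrow\Delta,\neg(\alpha\wedge\beta)$. ($\neg\vee$left$^t$) $\Gamma\Rightarrow\Delta,\alpha,\beta$ / $\neg(\alpha\vee\beta),\Gamma\Rightarrow\Delta$. ($\neg\vee$right$^t$) $\alpha,\Gamma\Rightarrow\Delta$; $\beta,\Gamma\Rightarrow\Delta$ / $\Gamma\Rightarrow\Delta,\neg(\alpha\vee\beta)$. ($\neg\to$left$^t$) $\alpha,\Gamma\Rightarrow\Delta,\beta$ / $\neg(\alpha\to\beta),\Gamma\Rightarrow\Delta$. ($\neg\to$right$^t$) $\Gamma\Rightarrow\Delta,\alpha$; $\beta,\Gamma\Rightarrow\Delta$ / $\Gamma\Rightarrow\Delta,\neg(\alpha\to\beta)$. ($\neg\Box$left$^t$) $\Box\Gamma_1,\neg\Diamond\Gamma_2\Rightarrow\Diamond\Delta_1,\neg\Box\Delta_2,\alpha$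 / $\neg\Box\alpha,\Box\Gamma_1,\neg\Diamond\Gamma_2\Rightarrow\Diamond\Delta_1,\neg\Box\Delta_2$. ($\neg\Box$right$^t$) $\alpha,\Gamma\Rightarrow\Delta$ / $\Gamma\Rightarrow\Delta,\neg\Box\alpha$. ($\neg\Diamond$left$^t$) $\Gamma\Rightarrow\Delta,\alpha$ / $\neg\Diamond\alpha,\Gamma\Rightarrow\Delta$. ($\neg\Diamond$right$^t$) $\alpha,\Box\Gamma_1,\neg\Diamond\Gamma_2\Rightarrow\Diamond\Delta_1,\neg\Box\Delta_2$ / $\Box\Gamma_1,\neg\Diamond\Gamma_2\Rightarrow\Diamond\Delta_1,\neg\Box\Delta_2,\neg\Diamond\alpha$. (lTS4 has no rules ($\neg$left), ($\neg$right).) The calculus gTS4 is obtained from lTS4 by replacing ($\Box$right), ($\Diamond$left), ($\neg\Box$left$^t$), ($\neg\Diamond$right$^t$) with: ($\Box$right$^T$) $\Box\Gamma_1,\Box\Delta_2\Rightarrow\Diamond\Delta_1,\Diamond\Gamma_2,\alpha$ / $\Box\Gamma_1,\neg\Diamond\Gamma_2\Rightarrow\Diamond\Delta_1,\neg\Box\Delta_2,\Box\alpha$. ($\Diamond$left$^T$) $\alpha,\Box\Gamma_1,\Box\Delta_2\Rightarrow\Diamond\Delta_1,\Diamond\Gamma_2$ / $\Diamond\alpha,\Box\Gamma_1,\neg\Diamond\Gamma_2\Rightarrow\Diamond\Delta_1,\neg\Box\Delta_2$. ($\neg\Box$left$^T$) $\Box\Gamma_1,\Box\Delta_2\Rightarrow\Diamond\Delta_1,\Diamond\Gamma_2,\alpha$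 / $\neg\Box\alpha,\Box\Gamma_1,\neg\Diamond\Gamma_2\Rightarrow\Diamond\Delta_1,\neg\Box\Delta_2$. ($\neg\Diamond$right$^T$) $\alpha,\Box\Gamma_1,\Box\Delta_2\Rightarrow\Diamond\Delta_1,\Diamond\Gamma_2$ / $\Box\Gamma_1,\neg\Diamond\Gamma_2\Rightarrow\Diamond\Delta_1,\neg\Box\Delta_2,\neg\Diamond\alpha$. (All other rules and initial sequents of lTS4, including ($\neg\Diamond$left$^t$), are kept.) -}

module Defs where

open import Data.Nat using (ℕ)
open import Data.Product using (_×_)
open import Data.Bool using (Bool; true; false)
open import Data.List using (List; []; _∷_; _++_; map)
open import Data.List.Relation.Binary.Subset.Propositional using (_⊆_)
open import Relation.Binary.PropositionalEquality using (_≡_)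

data Fm : Set where
  var  : ℕ → Fm
  and  : Fm → Fm → Fm
  or   : Fm → Fm → Fm
  imp  : Fm → Fm → Fm
  neg  : Fm → Fm
  box  : Fm → Fm
  dia  : Fm → Fm

data Calc : Set where
  lTS4 gTS4 : Calc

-- Finite sets of formulas are represented by lists; two lists denote the
-- same set iff they have the same members.  The rule `setEq` below makes
-- derivability depend only on the sets denoted (so a comma is union).
_≈ₛ_ : List Fm → List Fm → Set
Γ ≈ₛ Γ' = (Γ ⊆ Γ') × (Γ' ⊆ Γ)

MLeft : List Fm → List Fm → List Fm
MLeft Γ₁ Γ₂ = map box Γ₁ ++ map (λ x → neg (dia x)) Γ₂

MRight : List Fm → List Fm → List Fm
MRight Δ₁ Δ₂ = map dia Δ₁ ++ map (λ x → neg (box x)) Δ₂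

TLeft : List Fm → List Fm → List Fm
TLeft Γ₁ Δ₂ = map box Γ₁ ++ map box Δ₂

TRight : List Fm → List Fm → List Fm
TRight Δ₁ Γ₂ = map dia Δ₁ ++ map dia Γ₂

-- Der L c Γ Δ : the sequent Γ ⇒ Δ is derivable in L, where the cut rule
-- is available iff c ≡ true.  (Cut-free L is Der L false.)
data Der (L : Calc) (c : Bool) : List Fm → List Fm → Set where
  ax₁ : ∀ p → Der L c (var p ∷ []) (var p ∷ [])
  ax₂ : ∀ p → Der L c (neg (var p) ∷ []) (neg (var p) ∷ [])
  ax₃ : ∀ p → Der L c (neg (var p) ∷ var p ∷ []) []
  ax₄ : ∀ p → Der L c [] (neg (var p) ∷ var p ∷ [])
  setEq : ∀ {Γ Γ' Δ Δ'} → Γ ≈ₛ Γ' → Δ ≈ₛ Δ' → Der L c Γ Δ → Der L c Γ' Δ'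
  cut : ∀ {Γ Δ α} → c ≡ true → Der L c Γ (α ∷ []) → Der L c (α ∷ Γ) Δ → Der L c Γ Δ
  weL : ∀ {Γ Δ α} → Der L c Γ Δ → Der L c (α ∷ Γ) Δ
  weR : ∀ {Γ Δ α} → Der L c Γ Δ → Der L c Γ (α ∷ Δ)
  andL : ∀ {Γ Δ α β} → Der L c (α ∷ β ∷ Γ) Δ → Der L c (and α β ∷ Γ) Δ
  andR : ∀ {Γ Δ α β} → Der L c Γ (α ∷ Δ) → Der L c Γ (β ∷ Δ) → Der L c Γ (and α β ∷ Δ)
  orL  : ∀ {Γ Δ α β} → Der L c (α ∷ Γ) Δ → Der L c (β ∷ Γ) Δ → Der L c (or α β ∷ Γ) Δ
  orR  : ∀ {Γ Δ α β} → Der L c Γ (α ∷ β ∷ Δ) → Der L c Γ (or α β ∷ Δ)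
  impL : ∀ {Γ Δ α β} → Der L c Γ (α ∷ Δ) → Der L c (β ∷ Γ) Δ → Der L c (imp α β ∷ Γ) Δ
  impR : ∀ {Γ Δ α β} → Der L c (α ∷ Γ) (β ∷ Δ) → Der L c Γ (imp α β ∷ Δ)
  boxL : ∀ {Γ Δ α} → Der L c (α ∷ Γ) Δ → Der L c (box α ∷ Γ) Δ
  diaR : ∀ {Γ Δ α} → Der L c Γ (α ∷ Δ) → Der L c Γ (dia α ∷ Δ)
  boxR : ∀ {Γ₁ Γ₂ Δ₁ Δ₂ α} → L ≡ lTS4 →
    Der L c (MLeft Γ₁ Γ₂) (α ∷ MRight Δ₁ Δ₂) →
    Der L c (MLeft Γ₁ Γ₂) (box α ∷ MRight Δ₁ Δ₂)
  diaL : ∀ {Γ₁ Γ₂ Δ₁ Δ₂ α} → L ≡ lTS4 →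
    Der L c (α ∷ MLeft Γ₁ Γ₂) (MRight Δ₁ Δ₂) →
    Der L c (dia α ∷ MLeft Γ₁ Γ₂) (MRight Δ₁ Δ₂)
  negnegL : ∀ {Γ Δ α} → Der L c (α ∷ Γ) Δ → Der L c (neg (neg α) ∷ Γ) Δ
  negnegR : ∀ {Γ Δ α} → Der L c Γ (α ∷ Δ) → Der L c Γ (neg (neg α) ∷ Δ)
  negAndL : ∀ {Γ Δ α β} → Der L c Γ (α ∷ Δ) → Der L c Γ (β ∷ Δ) → Der L c (neg (and α β) ∷ Γ) Δ
  negAndR : ∀ {Γ Δ α β} → Der L c (α ∷ β ∷ Γ) Δ → Der L c Γ (neg (and α β) ∷ Δ)
  negOrL  : ∀ {Γ Δ α β} → Der L c Γ (α ∷ β ∷ Δ) → Der L c (neg (or α β) ∷ Γ) Δ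
  negOrR  : ∀ {Γ Δ α β} → Der L c (α ∷ Γ) Δ → Der L c (β ∷ Γ) Δ → Der L c Γ (neg (or α β) ∷ Δ)
  negImpL : ∀ {Γ Δ α β} → Der L c (α ∷ Γ) (β ∷ Δ) → Der L c (neg (imp α β) ∷ Γ) Δ
  negImpR : ∀ {Γ Δ α β} → Der L c Γ (α ∷ Δ) → Der L c (β ∷ Γ) Δ → Der L c Γ (neg (imp α β) ∷ Δ)
  negBoxR : ∀ {Γ Δ α} → Der L c (α ∷ Γ) Δ → Der L c Γ (neg (box α) ∷ Δ)
  negDiaL : ∀ {Γ Δ α} → Der L c Γ (α ∷ Δ) → Der L c (neg (dia α) ∷ Γ) Δ
  negBoxL : ∀ {Γ₁ Γ₂ Δ₁ Δ₂ α} → L ≡ lTS4 →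
    Der L c (MLeft Γ₁ Γ₂) (α ∷ MRight Δ₁ Δ₂) →
    Der L c (neg (box α) ∷ MLeft Γ₁ Γ₂) (MRight Δ₁ Δ₂)
  negDiaR : ∀ {Γ₁ Γ₂ Δ₁ Δ₂ α} → L ≡ lTS4 →
    Der L c (α ∷ MLeft Γ₁ Γ₂) (MRight Δ₁ Δ₂) →
    Der L c (MLeft Γ₁ Γ₂) (neg (dia α) ∷ MRight Δ₁ Δ₂)
  boxRT : ∀ {Γ₁ Γ₂ Δ₁ Δ₂ α} → L ≡ gTS4 →
    Der L c (TLeft Γ₁ Δ₂) (α ∷ TRight Δ₁ Γ₂) →
    Der L c (MLeft Γ₁ Γ₂) (box α ∷ MRight Δ₁ Δ₂)
  diaLT : ∀ {Γ₁ Γ₂ Δ₁ Δ₂ α} → L ≡ gTS4 →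
    Der L c (α ∷ TLeft Γ₁ Δ₂) (TRight Δ₁ Γ₂) →
    Der L c (dia α ∷ MLeft Γ₁ Γ₂) (MRight Δ₁ Δ₂)
  negBoxLT : ∀ {Γ₁ Γ₂ Δ₁ Δ₂ α} → L ≡ gTS4 →
    Der L c (TLeft Γ₁ Δ₂) (α ∷ TRight Δ₁ Γ₂) →
    Der L c (neg (box α) ∷ MLeft Γ₁ Γ₂) (MRight Δ₁ Δ₂)
  negDiaRT : ∀ {Γ₁ Γ₂ Δ₁ Δ₂ α} → L ≡ gTS4 →
    Der L c (α ∷ TLeft Γ₁ Δ₂) (TRight Δ₁ Γ₂) →
    Der L c (MLeft Γ₁ Γ₂) (neg (dia α) ∷ MRight Δ₁ Δ₂)

CutFree : Calc → List Fm → List Fm → Set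
CutFree L = Der L false

-- A formula y on side b of a sequent (true: antecedent, false: succedent) is read as its signed
-- normal form `normal b y`: strip the leading negations of y, switching sides at each one. Then α
-- in the succedent and ¬α in the antecedent have the same normal form, and both rules follow from
-- a stronger statement: if Γ ⇒ Δ is derivable and all its normal forms occur among those of
-- Γ′ ⇒ Δ′, then Γ′ ⇒ Δ′ is derivable. Each
-- rule and its twist have the same premises and principal formulas φ, ¬φ on opposite sides, hence
-- one normal form; in Γ′ ⇒ Δ′ it is carried by φ or by ¬φ up to double negations, so one of the two
-- rules, followed by ¬¬-rules and contraction, introduces it. For a modal rule the target is first
-- cut down to its modal part, the formulas that are □γ, ¬◇γ on the left or ◇γ, ¬□γ on the right up
-- to double negations: every formula of a modal context has a normal form (true , □γ) or
-- (false , ◇γ), so this part still covers the context of the source.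

module Submission where

open import Defs
open import Data.Bool using (Bool; true; false; not)
open import Data.Bool.Properties using (not-involutive; not-injective; not-¬)
open import Data.Empty using (⊥-elim)
open import Data.List using (List; []; _∷_; _++_; map; concatMap)
open import Data.List.Membership.Propositional using (_∈_; find; lose)
open import Data.List.Membership.Propositional.Properties
  using (∈-++⁺ˡ; ∈-++⁺ʳ; ∈-++⁻; ∈-map⁺; ∈-map⁻; ∈-concatMap⁺; ∈-concatMap⁻)
open import Data.List.Relation.Binary.Subset.Propositional using (_⊆_)
open import Data.List.Relation.Binary.Subset.Propositional.Properties
  using (⊆-refl; xs⊆xs++ys; ∈-∷⁺ʳ; All-resp-⊇)
open import Data.List.Relation.Unary.All as All using (All; []; _∷_)
open import Data.List.Relation.Unary.All.Properties as All using ()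
open import Data.List.Relation.Unary.Any using (here; there)
open import Data.Maybe using (Maybe; just; nothing)
open import Data.Product using (_×_; _,_; ∃-syntax)
open import Data.Sum using (_⊎_; inj₁; inj₂; [_,_]′)
open import Function using (id)
open import Relation.Binary.PropositionalEquality using (_≡_; refl; sym; subst)

normal : Bool → Fm → Bool × Fm
normal b (neg x) = normal (not b) x
normal b x       = b , x

infix 4 _⊒_

data _⊒_ : Fm → Fm → Set where
  ⊒-refl : ∀ {x} → x ⊒ x
  ⊒-¬¬   : ∀ {x y} → y ⊒ neg (neg x) → y ⊒ x

⊒-neg : ∀ {x y} → y ⊒ x → neg y ⊒ neg x
⊒-neg ⊒-refl   = ⊒-refl
⊒-neg (⊒-¬¬ p) = ⊒-¬¬ (⊒-neg p)

normal-⊒ : ∀ {b c y φ} → normal b y ≡ (c , φ) →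
           (b ≡ c × y ⊒ φ) ⊎ (b ≡ not c × y ⊒ neg φ)
normal-⊒ {b} {y = neg y} e with normal-⊒ {not b} {y = y} e
... | inj₁ (refl , p) = inj₂ (sym (not-involutive b) , ⊒-neg p)
... | inj₂ (e′ , p)   = inj₁ (not-injective e′ , ⊒-¬¬ (⊒-neg p))
normal-⊒ {y = var _}   refl = inj₁ (refl , ⊒-refl)
normal-⊒ {y = and _ _} refl = inj₁ (refl , ⊒-refl)
normal-⊒ {y = or _ _}  refl = inj₁ (refl , ⊒-refl)
normal-⊒ {y = imp _ _} refl = inj₁ (refl , ⊒-refl)
normal-⊒ {y = box _}   refl = inj₁ (refl , ⊒-refl)
normal-⊒ {y = dia _}   refl = inj₁ (refl , ⊒-refl)

normal-same-⊒ : ∀ {b y φ} → normal b y ≡ (b , φ) → y ⊒ φ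
normal-same-⊒ e with normal-⊒ e
... | inj₁ (_ , p)  = p
... | inj₂ (e′ , _) = ⊥-elim (not-¬ refl e′)

normal-opposite-⊒ : ∀ {b y φ} → normal b y ≡ (not b , φ) → y ⊒ neg φ
normal-opposite-⊒ e with normal-⊒ e
... | inj₁ (e′ , _) = ⊥-elim (not-¬ refl e′)
... | inj₂ (_ , p)  = p

data Key (Γ Δ : List Fm) (k : Bool × Fm) : Set where
  ante : ∀ {y} → y ∈ Γ → normal true y ≡ k → Key Γ Δ k
  succ : ∀ {y} → y ∈ Δ → normal false y ≡ k → Key Γ Δ k

Key-mono : ∀ {Γ Δ Γ′ Δ′ k} → Γ ⊆ Γ′ → Δ ⊆ Δ′ → Key Γ Δ k → Key Γ′ Δ′ k
Key-mono s t (ante m e) = ante (s m) e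
Key-mono s t (succ m e) = succ (t m) e

infix 4 _⊑_

_⊑_ : List Fm × List Fm → List Fm × List Fm → Set
(Γ , Δ) ⊑ (Γ′ , Δ′) = All (λ x → Key Γ′ Δ′ (normal true x)) Γ × All (λ x → Key Γ′ Δ′ (normal false x)) Δ

⊑-refl : ∀ {Γ Δ} → (Γ , Δ) ⊑ (Γ , Δ)
⊑-refl = All.tabulate (λ m → ante m refl) , All.tabulate (λ m → succ m refl)

⊑-Key : ∀ {Γ Δ Γ′ Δ′ k} → (Γ , Δ) ⊑ (Γ′ , Δ′) → Key Γ Δ k → Key Γ′ Δ′ k
⊑-Key (a , b) (ante m refl) = All.lookup a m
⊑-Key (a , b) (succ m refl) = All.lookup b m

⊑-trans : ∀ {Γ Δ Γ′ Δ′ Γ″ Δ″} → (Γ , Δ) ⊑ (Γ′ , Δ′) → (Γ′ , Δ′) ⊑ (Γ″ , Δ″) → (Γ , Δ) ⊑ (Γ″ , Δ″)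
⊑-trans (a , b) c = All.map (⊑-Key c) a , All.map (⊑-Key c) b

⊑-addˡ : ∀ {x Γ Δ Γ′ Δ′} → (Γ , Δ) ⊑ (Γ′ , Δ′) → (x ∷ Γ , Δ) ⊑ (x ∷ Γ′ , Δ′)
⊑-addˡ (a , b) = ante (here refl) refl ∷ All.map (Key-mono there id) a , All.map (Key-mono there id) b

⊑-addʳ : ∀ {x Γ Δ Γ′ Δ′} → (Γ , Δ) ⊑ (Γ′ , Δ′) → (Γ , x ∷ Δ) ⊑ (Γ′ , x ∷ Δ′)
⊑-addʳ (a , b) = All.map (Key-mono id there) a , succ (here refl) refl ∷ All.map (Key-mono id there) b

⊑-¬ˡ : ∀ {α Γ Δ} → (Γ , α ∷ Δ) ⊑ (neg α ∷ Γ , Δ)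
⊑-¬ˡ = All.tabulate (λ m → ante (there m) refl) , ante (here refl) refl ∷ All.tabulate (λ m → succ m refl)

⊑-¬ʳ : ∀ {α Γ Δ} → (α ∷ Γ , Δ) ⊑ (Γ , neg α ∷ Δ)
⊑-¬ʳ = succ (here refl) refl ∷ All.tabulate (λ m → ante m refl) , All.tabulate (λ m → succ (there m) refl)

data ModalKey : Bool × Fm → Set where
  □ : ∀ γ → ModalKey (true , box γ)
  ◇ : ∀ γ → ModalKey (false , dia γ)

modalKey? : ∀ k → Maybe (ModalKey k)
modalKey? (true , box γ)  = just (□ γ)
modalKey? (false , dia γ) = just (◇ γ)
modalKey? _               = nothing

boxOf diaOf : ∀ {k} → Maybe (ModalKey k) → List Fm
boxOf (just (□ γ)) = γ ∷ []
boxOf _            = []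
diaOf (just (◇ γ)) = γ ∷ []
diaOf _            = []

boxOf-∈ : ∀ {k γ} (m : Maybe (ModalKey k)) → γ ∈ boxOf m → k ≡ (true , box γ)
boxOf-∈ (just (□ _)) (here refl) = refl
boxOf-∈ (just (□ _)) (there ())
boxOf-∈ (just (◇ _)) ()
boxOf-∈ nothing      ()

diaOf-∈ : ∀ {k γ} (m : Maybe (ModalKey k)) → γ ∈ diaOf m → k ≡ (false , dia γ)
diaOf-∈ (just (◇ _)) (here refl) = refl
diaOf-∈ (just (◇ _)) (there ())
diaOf-∈ (just (□ _)) ()
diaOf-∈ nothing      ()

boxesIn diasIn : Bool → List Fm → List Fm
boxesIn b = concatMap λ y → boxOf (modalKey? (normal b y))
diasIn  b = concatMap λ y → diaOf (modalKey? (normal b y))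

boxesIn-sound : ∀ {b γ Γ} → γ ∈ boxesIn b Γ → ∃[ y ] y ∈ Γ × normal b y ≡ (true , box γ)
boxesIn-sound {b} m with find (∈-concatMap⁻ _ m)
... | y , y∈Γ , γ∈ = y , y∈Γ , boxOf-∈ (modalKey? (normal b y)) γ∈

diasIn-sound : ∀ {b γ Γ} → γ ∈ diasIn b Γ → ∃[ y ] y ∈ Γ × normal b y ≡ (false , dia γ)
diasIn-sound {b} m with find (∈-concatMap⁻ _ m)
... | y , y∈Γ , γ∈ = y , y∈Γ , diaOf-∈ (modalKey? (normal b y)) γ∈

boxesIn-complete : ∀ {b γ y Γ} → y ∈ Γ → normal b y ≡ (true , box γ) → γ ∈ boxesIn b Γ
boxesIn-complete {b} {γ} y∈Γ e =
  ∈-concatMap⁺ _ (lose y∈Γ (subst (λ k → γ ∈ boxOf (modalKey? k)) (sym e) (here refl)))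

diasIn-complete : ∀ {b γ y Γ} → y ∈ Γ → normal b y ≡ (false , dia γ) → γ ∈ diasIn b Γ
diasIn-complete {b} {γ} y∈Γ e =
  ∈-concatMap⁺ _ (lose y∈Γ (subst (λ k → γ ∈ diaOf (modalKey? k)) (sym e) (here refl)))

modalˡ modalʳ : List Fm → List Fm
modalˡ Γ = MLeft (boxesIn true Γ) (diasIn true Γ)
modalʳ Δ = MRight (diasIn false Δ) (boxesIn false Δ)

modalᵀˡ modalᵀʳ : List Fm → List Fm → List Fm
modalᵀˡ Γ Δ = TLeft (boxesIn true Γ) (boxesIn false Δ)
modalᵀʳ Γ Δ = TRight (diasIn false Δ) (diasIn true Γ)

infix 4 _⊆¬¬_

_⊆¬¬_ : List Fm → List Fm → Set
A ⊆¬¬ B = ∀ {x} → x ∈ A → ∃[ y ] y ∈ B × y ⊒ x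

⊆¬¬-∷ : ∀ {x A B} → A ⊆¬¬ B → x ∷ A ⊆¬¬ x ∷ B
⊆¬¬-∷ s (here refl) = _ , here refl , ⊒-refl
⊆¬¬-∷ s (there m) with s m
... | y , y∈B , y⊒x = y , there y∈B , y⊒x

modalˡ-⊆¬¬ : ∀ {Γ} → modalˡ Γ ⊆¬¬ Γ
modalˡ-⊆¬¬ {Γ} m with ∈-++⁻ (map box (boxesIn true Γ)) m
... | inj₁ l with ∈-map⁻ box l
...   | _ , γ∈ , refl with boxesIn-sound γ∈
...     | y , y∈Γ , e = y , y∈Γ , normal-same-⊒ e
modalˡ-⊆¬¬ m | inj₂ r with ∈-map⁻ _ r
...   | _ , γ∈ , refl with diasIn-sound γ∈
...     | y , y∈Γ , e = y , y∈Γ , normal-opposite-⊒ e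

modalʳ-⊆¬¬ : ∀ {Δ} → modalʳ Δ ⊆¬¬ Δ
modalʳ-⊆¬¬ {Δ} m with ∈-++⁻ (map dia (diasIn false Δ)) m
... | inj₁ l with ∈-map⁻ dia l
...   | _ , γ∈ , refl with diasIn-sound γ∈
...     | y , y∈Δ , e = y , y∈Δ , normal-same-⊒ e
modalʳ-⊆¬¬ m | inj₂ r with ∈-map⁻ _ r
...   | _ , γ∈ , refl with boxesIn-sound γ∈
...     | y , y∈Δ , e = y , y∈Δ , normal-opposite-⊒ e

modal-Key : ∀ {Γ Δ k} → ModalKey k → Key Γ Δ k → Key (modalˡ Γ) (modalʳ Δ) k
modal-Key {Γ} (□ γ) (ante m e) =
  ante (∈-++⁺ˡ (∈-map⁺ box (boxesIn-complete m e))) refl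
modal-Key {Δ = Δ} (□ γ) (succ m e) =
  succ (∈-++⁺ʳ (map dia (diasIn false Δ)) (∈-map⁺ (λ x → neg (box x)) (boxesIn-complete m e))) refl
modal-Key {Γ} (◇ γ) (ante m e) =
  ante (∈-++⁺ʳ (map box (boxesIn true Γ)) (∈-map⁺ (λ x → neg (dia x)) (diasIn-complete m e))) refl
modal-Key (◇ γ) (succ m e) =
  succ (∈-++⁺ˡ (∈-map⁺ dia (diasIn-complete m e))) refl

⊑-modal : ∀ Γ₁ Γ₂ Δ₁ Δ₂ {Γ Δ} → (MLeft Γ₁ Γ₂ , MRight Δ₁ Δ₂) ⊑ (Γ , Δ) →
          (MLeft Γ₁ Γ₂ , MRight Δ₁ Δ₂) ⊑ (modalˡ Γ , modalʳ Δ)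
⊑-modal Γ₁ Γ₂ Δ₁ Δ₂ (a , b) =
  All.zipWith (λ (mk , h) → modal-Key mk h) (modalˡ-keys , a) ,
  All.zipWith (λ (mk , h) → modal-Key mk h) (modalʳ-keys , b)
  where
  modalˡ-keys : All (λ x → ModalKey (normal true x)) (MLeft Γ₁ Γ₂)
  modalˡ-keys = All.++⁺ (All.map⁺ (All.universal □ Γ₁)) (All.map⁺ (All.universal ◇ Γ₂))
  modalʳ-keys : All (λ x → ModalKey (normal false x)) (MRight Δ₁ Δ₂)
  modalʳ-keys = All.++⁺ (All.map⁺ (All.universal ◇ Δ₁)) (All.map⁺ (All.universal □ Δ₂))

⊑-M⇒T : ∀ {A B C D Γ Δ} → (MLeft A B , MRight C D) ⊑ (Γ , Δ) → (TLeft A D , TRight C B) ⊑ (Γ , Δ)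
⊑-M⇒T {A} {C = C} (a , b) with All.++⁻ (map box A) a | All.++⁻ (map dia C) b
... | a₁ , a₂ | b₁ , b₂ = All.++⁺ a₁ (All.map⁺ (All.map⁻ b₂)) , All.++⁺ b₁ (All.map⁺ (All.map⁻ a₂))

⊑-T⇒M : ∀ {A B C D Γ Δ} → (TLeft A D , TRight C B) ⊑ (Γ , Δ) → (MLeft A B , MRight C D) ⊑ (Γ , Δ)
⊑-T⇒M {A} {C = C} (a , b) with All.++⁻ (map box A) a | All.++⁻ (map dia C) b
... | a₁ , a₂ | b₁ , b₂ = All.++⁺ a₁ (All.map⁺ (All.map⁻ b₂)) , All.++⁺ b₁ (All.map⁺ (All.map⁻ a₂))

⊑-modalᵀ : ∀ Γ₁ Γ₂ Δ₁ Δ₂ {Γ Δ} → (MLeft Γ₁ Γ₂ , MRight Δ₁ Δ₂) ⊑ (Γ , Δ) →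
           (TLeft Γ₁ Δ₂ , TRight Δ₁ Γ₂) ⊑ (modalᵀˡ Γ Δ , modalᵀʳ Γ Δ)
⊑-modalᵀ Γ₁ Γ₂ Δ₁ Δ₂ {Γ} {Δ} c =
  ⊑-trans (⊑-M⇒T {Γ₁} {Γ₂} {Δ₁} {Δ₂} (⊑-modal Γ₁ Γ₂ Δ₁ Δ₂ c))
          (⊑-T⇒M {boxesIn true Γ} {diasIn true Γ} {diasIn false Δ} {boxesIn false Δ} ⊑-refl)

module _ (L : Calc) where

  infix 4 ⊢_⇒_ ⊢_⇒_⊕_

  ⊢_⇒_ : List Fm → List Fm → Set
  ⊢ Γ ⇒ Δ = CutFree L Γ Δ

  ⊢_⇒_⊕_ : List Fm → List Fm → Bool × Fm → Set
  ⊢ Γ ⇒ Δ ⊕ (true , x)  = ⊢ x ∷ Γ ⇒ Δ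
  ⊢ Γ ⇒ Δ ⊕ (false , x) = ⊢ Γ ⇒ x ∷ Δ

  weakenˡ : ∀ A {Γ Δ} → ⊢ Γ ⇒ Δ → ⊢ A ++ Γ ⇒ Δ
  weakenˡ []      d = d
  weakenˡ (_ ∷ A) d = weL (weakenˡ A d)

  weakenʳ : ∀ A {Γ Δ} → ⊢ Γ ⇒ Δ → ⊢ Γ ⇒ A ++ Δ
  weakenʳ []      d = d
  weakenʳ (_ ∷ A) d = weR (weakenʳ A d)

  weaken : ∀ {Γ Δ Γ′ Δ′} → ⊢ Γ ⇒ Δ → Γ ⊆ Γ′ → Δ ⊆ Δ′ → ⊢ Γ′ ⇒ Δ′
  weaken {Γ} {Δ} {Γ′} {Δ′} d s t =
    setEq (absorb s , xs⊆xs++ys Γ′ Γ) (absorb t , xs⊆xs++ys Δ′ Δ) (weakenʳ Δ′ (weakenˡ Γ′ d))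
    where
    absorb : ∀ {A B} → B ⊆ A → A ++ B ⊆ A
    absorb {A} s m = [ id , s ]′ (∈-++⁻ A m)

  ⊒-lift : ∀ {b x y Γ Δ} → y ⊒ x → ⊢ Γ ⇒ Δ ⊕ (b , x) → ⊢ Γ ⇒ Δ ⊕ (b , y)
  ⊒-lift         ⊒-refl   d = d
  ⊒-lift {true}  (⊒-¬¬ p) d = ⊒-lift {true} p (negnegL d)
  ⊒-lift {false} (⊒-¬¬ p) d = ⊒-lift {false} p (negnegR d)

  from-normal : ∀ b y {c φ Γ Δ} → normal b y ≡ (c , φ) →
           ⊢ Γ ⇒ Δ ⊕ (c , φ) → ⊢ Γ ⇒ Δ ⊕ (not c , neg φ) → ⊢ Γ ⇒ Δ ⊕ (b , y)
  from-normal b y e p q with normal-⊒ {b} {y = y} e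
  ... | inj₁ (refl , y⊒φ)  = ⊒-lift y⊒φ p
  ... | inj₂ (refl , y⊒¬φ) = ⊒-lift y⊒¬φ q

  realize : ∀ {c φ Γ Δ} → Key Γ Δ (c , φ) →
            ⊢ Γ ⇒ Δ ⊕ (c , φ) → ⊢ Γ ⇒ Δ ⊕ (not c , neg φ) → ⊢ Γ ⇒ Δ
  realize (ante {y} y∈Γ e) p q = weaken (from-normal true y e p q) (∈-∷⁺ʳ y∈Γ ⊆-refl) ⊆-refl
  realize (succ {y} y∈Δ e) p q = weaken (from-normal false y e p q) ⊆-refl (∈-∷⁺ʳ y∈Δ ⊆-refl)

  absorbˡ : ∀ A {Γ Δ} → ⊢ A ++ Γ ⇒ Δ → A ⊆¬¬ Γ → ⊢ Γ ⇒ Δ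
  absorbˡ []      d s = d
  absorbˡ (x ∷ A) d s with s (here refl)
  ... | y , y∈Γ , y⊒x =
    absorbˡ A (weaken (⊒-lift {true} y⊒x d) (∈-∷⁺ʳ (∈-++⁺ʳ A y∈Γ) ⊆-refl) ⊆-refl) (λ m → s (there m))

  absorbʳ : ∀ A {Γ Δ} → ⊢ Γ ⇒ A ++ Δ → A ⊆¬¬ Δ → ⊢ Γ ⇒ Δ
  absorbʳ []      d s = d
  absorbʳ (x ∷ A) d s with s (here refl)
  ... | y , y∈Δ , y⊒x =
    absorbʳ A (weaken (⊒-lift {false} y⊒x d) ⊆-refl (∈-∷⁺ʳ (∈-++⁺ʳ A y∈Δ) ⊆-refl)) (λ m → s (there m))

  embed : ∀ {Γ Δ Γ′ Δ′} → ⊢ Γ ⇒ Δ → Γ ⊆¬¬ Γ′ → Δ ⊆¬¬ Δ′ → ⊢ Γ′ ⇒ Δ′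
  embed {Γ} {Δ} {Γ′} {Δ′} d s t =
    absorbʳ Δ (absorbˡ Γ (weaken d (xs⊆xs++ys Γ Γ′) (xs⊆xs++ys Δ Δ′)) s) t

  embed-modal : ∀ b {x Γ Δ} → ⊢ modalˡ Γ ⇒ modalʳ Δ ⊕ (b , x) → ⊢ Γ ⇒ Δ ⊕ (b , x)
  embed-modal true  d = embed d (⊆¬¬-∷ modalˡ-⊆¬¬) modalʳ-⊆¬¬
  embed-modal false d = embed d modalˡ-⊆¬¬ (⊆¬¬-∷ modalʳ-⊆¬¬)

  realize-modal : ∀ {c φ Γ Δ} → Key Γ Δ (c , φ) → ⊢ modalˡ Γ ⇒ modalʳ Δ ⊕ (c , φ) →
                  ⊢ modalˡ Γ ⇒ modalʳ Δ ⊕ (not c , neg φ) → ⊢ Γ ⇒ Δ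
  realize-modal {c} h p q = realize h (embed-modal c p) (embed-modal (not c) q)

  atom : ∀ {p Γ Δ} → Key Γ Δ (true , var p) → Key Γ Δ (false , var p) → ⊢ Γ ⇒ Δ
  atom {p} {Γ} {Δ} t f =
    realize f (realize (Key-mono id there t) p⇒p ⇒¬p,p) (realize (Key-mono there id t) p,¬p⇒ ¬p⇒¬p)
    where
    p⇒p : ⊢ var p ∷ Γ ⇒ var p ∷ Δ
    p⇒p = weaken (ax₁ p) (xs⊆xs++ys _ Γ) (xs⊆xs++ys _ Δ)
    ⇒¬p,p : ⊢ Γ ⇒ neg (var p) ∷ var p ∷ Δ
    ⇒¬p,p = weaken (ax₄ p) (λ ()) (xs⊆xs++ys _ Δ)
    p,¬p⇒ : ⊢ var p ∷ neg (var p) ∷ Γ ⇒ Δ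
    p,¬p⇒ = weaken (ax₃ p) (∈-∷⁺ʳ (there (here refl)) (∈-∷⁺ʳ (here refl) (λ ()))) (λ ())
    ¬p⇒¬p : ⊢ neg (var p) ∷ Γ ⇒ neg (var p) ∷ Δ
    ¬p⇒¬p = weaken (ax₂ p) (xs⊆xs++ys _ Γ) (xs⊆xs++ys _ Δ)

  T∧ : ∀ {α β Γ Δ} → Key Γ Δ (true , and α β) → ⊢ α ∷ β ∷ Γ ⇒ Δ → ⊢ Γ ⇒ Δ
  T∧ h d = realize h (andL d) (negAndR d)

  F∧ : ∀ {α β Γ Δ} → Key Γ Δ (false , and α β) → ⊢ Γ ⇒ α ∷ Δ → ⊢ Γ ⇒ β ∷ Δ → ⊢ Γ ⇒ Δ
  F∧ h d e = realize h (andR d e) (negAndL d e)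

  T∨ : ∀ {α β Γ Δ} → Key Γ Δ (true , or α β) → ⊢ α ∷ Γ ⇒ Δ → ⊢ β ∷ Γ ⇒ Δ → ⊢ Γ ⇒ Δ
  T∨ h d e = realize h (orL d e) (negOrR d e)

  F∨ : ∀ {α β Γ Δ} → Key Γ Δ (false , or α β) → ⊢ Γ ⇒ α ∷ β ∷ Δ → ⊢ Γ ⇒ Δ
  F∨ h d = realize h (orR d) (negOrL d)

  T→ : ∀ {α β Γ Δ} → Key Γ Δ (true , imp α β) → ⊢ Γ ⇒ α ∷ Δ → ⊢ β ∷ Γ ⇒ Δ → ⊢ Γ ⇒ Δ
  T→ h d e = realize h (impL d e) (negImpR d e)

  F→ : ∀ {α β Γ Δ} → Key Γ Δ (false , imp α β) → ⊢ α ∷ Γ ⇒ β ∷ Δ → ⊢ Γ ⇒ Δ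
  F→ h d = realize h (impR d) (negImpL d)

  T□ : ∀ {α Γ Δ} → Key Γ Δ (true , box α) → ⊢ α ∷ Γ ⇒ Δ → ⊢ Γ ⇒ Δ
  T□ h d = realize h (boxL d) (negBoxR d)

  F◇ : ∀ {α Γ Δ} → Key Γ Δ (false , dia α) → ⊢ Γ ⇒ α ∷ Δ → ⊢ Γ ⇒ Δ
  F◇ h d = realize h (diaR d) (negDiaL d)

  module _ {Γ Δ : List Fm} where
    private
      □ˡ ◇ˡ ◇ʳ □ʳ : List Fm
      □ˡ = boxesIn true Γ
      ◇ˡ = diasIn true Γ
      ◇ʳ = diasIn false Δ
      □ʳ = boxesIn false Δ

    F□ˡ : ∀ {α} → L ≡ lTS4 → Key Γ Δ (false , box α) → ⊢ modalˡ Γ ⇒ α ∷ modalʳ Δ → ⊢ Γ ⇒ Δ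
    F□ˡ e h d =
      realize-modal h (boxR {Γ₁ = □ˡ} {Γ₂ = ◇ˡ} {Δ₁ = ◇ʳ} {Δ₂ = □ʳ} e d)
                      (negBoxL {Γ₁ = □ˡ} {Γ₂ = ◇ˡ} {Δ₁ = ◇ʳ} {Δ₂ = □ʳ} e d)

    T◇ˡ : ∀ {α} → L ≡ lTS4 → Key Γ Δ (true , dia α) → ⊢ α ∷ modalˡ Γ ⇒ modalʳ Δ → ⊢ Γ ⇒ Δ
    T◇ˡ e h d =
      realize-modal h (diaL {Γ₁ = □ˡ} {Γ₂ = ◇ˡ} {Δ₁ = ◇ʳ} {Δ₂ = □ʳ} e d)
                      (negDiaR {Γ₁ = □ˡ} {Γ₂ = ◇ˡ} {Δ₁ = ◇ʳ} {Δ₂ = □ʳ} e d)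

    F□ᵍ : ∀ {α} → L ≡ gTS4 → Key Γ Δ (false , box α) → ⊢ modalᵀˡ Γ Δ ⇒ α ∷ modalᵀʳ Γ Δ → ⊢ Γ ⇒ Δ
    F□ᵍ e h d =
      realize-modal h (boxRT {Γ₁ = □ˡ} {Γ₂ = ◇ˡ} {Δ₁ = ◇ʳ} {Δ₂ = □ʳ} e d)
                      (negBoxLT {Γ₁ = □ˡ} {Γ₂ = ◇ˡ} {Δ₁ = ◇ʳ} {Δ₂ = □ʳ} e d)

    T◇ᵍ : ∀ {α} → L ≡ gTS4 → Key Γ Δ (true , dia α) → ⊢ α ∷ modalᵀˡ Γ Δ ⇒ modalᵀʳ Γ Δ → ⊢ Γ ⇒ Δ
    T◇ᵍ e h d =
      realize-modal h (diaLT {Γ₁ = □ˡ} {Γ₂ = ◇ˡ} {Δ₁ = ◇ʳ} {Δ₂ = □ʳ} e d)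
                      (negDiaRT {Γ₁ = □ˡ} {Γ₂ = ◇ˡ} {Δ₁ = ◇ʳ} {Δ₂ = □ʳ} e d)

  transfer : ∀ {Γ Δ Γ′ Δ′} → ⊢ Γ ⇒ Δ → (Γ , Δ) ⊑ (Γ′ , Δ′) → ⊢ Γ′ ⇒ Δ′
  transfer (ax₁ p) (t ∷ [] , f ∷ [])     = atom t f
  transfer (ax₂ p) (f ∷ [] , t ∷ [])     = atom t f
  transfer (ax₃ p) (f ∷ t ∷ [] , [])     = atom t f
  transfer (ax₄ p) ([] , t ∷ f ∷ [])     = atom t f
  transfer (setEq (Γ⊆ , _) (Δ⊆ , _) d) (a , b) = transfer d (All-resp-⊇ Γ⊆ a , All-resp-⊇ Δ⊆ b)
  transfer (cut () _ _)
  transfer (weL d)      (_ ∷ a , b)     = transfer d (a , b)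
  transfer (weR d)      (a , _ ∷ b)     = transfer d (a , b)
  transfer (negnegL d)  (h ∷ a , b)     = transfer d (h ∷ a , b)
  transfer (negnegR d)  (a , h ∷ b)     = transfer d (a , h ∷ b)
  transfer (andL d)     (h ∷ a , b)     = T∧ h (transfer d (⊑-addˡ (⊑-addˡ (a , b))))
  transfer (negAndR d)  (a , h ∷ b)     = T∧ h (transfer d (⊑-addˡ (⊑-addˡ (a , b))))
  transfer (andR d e)   (a , h ∷ b)     = F∧ h (transfer d (⊑-addʳ (a , b))) (transfer e (⊑-addʳ (a , b)))
  transfer (negAndL d e) (h ∷ a , b)    = F∧ h (transfer d (⊑-addʳ (a , b))) (transfer e (⊑-addʳ (a , b)))
  transfer (orL d e)    (h ∷ a , b)     = T∨ h (transfer d (⊑-addˡ (a , b))) (transfer e (⊑-addˡ (a , b)))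
  transfer (negOrR d e) (a , h ∷ b)     = T∨ h (transfer d (⊑-addˡ (a , b))) (transfer e (⊑-addˡ (a , b)))
  transfer (orR d)      (a , h ∷ b)     = F∨ h (transfer d (⊑-addʳ (⊑-addʳ (a , b))))
  transfer (negOrL d)   (h ∷ a , b)     = F∨ h (transfer d (⊑-addʳ (⊑-addʳ (a , b))))
  transfer (impL d e)   (h ∷ a , b)     = T→ h (transfer d (⊑-addʳ (a , b))) (transfer e (⊑-addˡ (a , b)))
  transfer (negImpR d e) (a , h ∷ b)    = T→ h (transfer d (⊑-addʳ (a , b))) (transfer e (⊑-addˡ (a , b)))
  transfer (impR d)     (a , h ∷ b)     = F→ h (transfer d (⊑-addˡ (⊑-addʳ (a , b))))
  transfer (negImpL d)  (h ∷ a , b)     = F→ h (transfer d (⊑-addˡ (⊑-addʳ (a , b))))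
  transfer (boxL d)     (h ∷ a , b)     = T□ h (transfer d (⊑-addˡ (a , b)))
  transfer (negBoxR d)  (a , h ∷ b)     = T□ h (transfer d (⊑-addˡ (a , b)))
  transfer (diaR d)     (a , h ∷ b)     = F◇ h (transfer d (⊑-addʳ (a , b)))
  transfer (negDiaL d)  (h ∷ a , b)     = F◇ h (transfer d (⊑-addʳ (a , b)))
  transfer (boxR {Γ₁} {Γ₂} {Δ₁} {Δ₂} e d) (a , h ∷ b) =
    F□ˡ e h (transfer d (⊑-addʳ (⊑-modal Γ₁ Γ₂ Δ₁ Δ₂ (a , b))))
  transfer (negBoxL {Γ₁} {Γ₂} {Δ₁} {Δ₂} e d) (h ∷ a , b) =
    F□ˡ e h (transfer d (⊑-addʳ (⊑-modal Γ₁ Γ₂ Δ₁ Δ₂ (a , b))))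
  transfer (diaL {Γ₁} {Γ₂} {Δ₁} {Δ₂} e d) (h ∷ a , b) =
    T◇ˡ e h (transfer d (⊑-addˡ (⊑-modal Γ₁ Γ₂ Δ₁ Δ₂ (a , b))))
  transfer (negDiaR {Γ₁} {Γ₂} {Δ₁} {Δ₂} e d) (a , h ∷ b) =
    T◇ˡ e h (transfer d (⊑-addˡ (⊑-modal Γ₁ Γ₂ Δ₁ Δ₂ (a , b))))
  transfer (boxRT {Γ₁} {Γ₂} {Δ₁} {Δ₂} e d) (a , h ∷ b) =
    F□ᵍ e h (transfer d (⊑-addʳ (⊑-modalᵀ Γ₁ Γ₂ Δ₁ Δ₂ (a , b))))
  transfer (negBoxLT {Γ₁} {Γ₂} {Δ₁} {Δ₂} e d) (h ∷ a , b) =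
    F□ᵍ e h (transfer d (⊑-addʳ (⊑-modalᵀ Γ₁ Γ₂ Δ₁ Δ₂ (a , b))))
  transfer (diaLT {Γ₁} {Γ₂} {Δ₁} {Δ₂} e d) (h ∷ a , b) =
    T◇ᵍ e h (transfer d (⊑-addˡ (⊑-modalᵀ Γ₁ Γ₂ Δ₁ Δ₂ (a , b))))
  transfer (negDiaRT {Γ₁} {Γ₂} {Δ₁} {Δ₂} e d) (a , h ∷ b) =
    T◇ᵍ e h (transfer d (⊑-addˡ (⊑-modalᵀ Γ₁ Γ₂ Δ₁ Δ₂ (a , b))))

  ¬left-admissible : (Γ Δ : List Fm) (α : Fm) → ⊢ Γ ⇒ α ∷ Δ → ⊢ neg α ∷ Γ ⇒ Δ
  ¬left-admissible Γ Δ α d = transfer d ⊑-¬ˡ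

  ¬right-admissible : (Γ Δ : List Fm) (α : Fm) → ⊢ α ∷ Γ ⇒ Δ → ⊢ Γ ⇒ neg α ∷ Δ
  ¬right-admissible Γ Δ α d = transfer d ⊑-¬ʳ

theorem4p1 : (L : Calc) →
    ((Γ Δ : List Fm) (α : Fm) → CutFree L Γ (α ∷ Δ) → CutFree L (neg α ∷ Γ) Δ) ×
    ((Γ Δ : List Fm) (α : Fm) → CutFree L (α ∷ Γ) Δ → CutFree L Γ (neg α ∷ Δ))
theorem4p1 L = ¬left-admissible L , ¬right-admissible L
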